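{- Let $q\ge 2$ be a prime power and let $B_q$ and $H_q$ be the graphs defined in the context. Then $B_q$ is $q$-regular, has girth $8$ and order $2q^3$, and is isomorphic to $H_q$.
   Context: Let $\mathbb{F}_q$ be the finite field with $q$ elements. $H_q$ is the bipartite graph with partite sets $\{(a,b,c)_r : a,b,c\in\mathbb{F}_q\}$, $r=0,1$, in which for all $a,b,c\in\mathbb{F}_q$ the neighbourhood of $(a,b,c)_1$ is $\{(x,\,ax+b,\,a^2x+c)_0 : x\in\mathbb{F}_q\}$. $B_q$ is the bipartite graph with the same vertex set, in which for all $a,b,c\in\mathbb{F}_q$ the neighbourhood of $(a,b,c)_1$ is $\{(j,\,aj+b,\,a^2j+2ab+c)_0 : j\in\mathbb{F}_q\}$. -}

module Defs where

open import Level using (0ℓ)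
open import Data.Nat using (ℕ; suc; _≤_; _<_; _^_)
open import Data.Nat.Primality using (Prime)
open import Data.Fin using (Fin; toℕ; fromℕ<; zero)
open import Data.Bool using (Bool; true; false)
open import Data.Product using (Σ; ∃; _×_; _,_)
open import Data.Sum using (_⊎_)
open import Data.Empty using (⊥)
open import Relation.Nullary using (¬_)
open import Relation.Binary.PropositionalEquality using (_≡_; _≢_)
import Algebra.Structures as AS
open import Function.Bundles using (_↔_; Inverse)
open import Function.Definitions using (Injective)

IsPrimePower : ℕ → Set
IsPrimePower q = Σ ℕ λ p → Σ ℕ λ k → Prime p × q ≡ p ^ suc k

record FiniteField (q : ℕ) : Set₁ where
  infixl 6 _+_
  infixl 7 _*_
  field
    Carrier           : Set
    _+_ _*_           : Carrier → Carrier → Carrier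
    -_                : Carrier → Carrier
    0# 1#             : Carrier
    isCommutativeRing : AS.IsCommutativeRing {A = Carrier} _≡_ _+_ _*_ -_ 0# 1#
    0≢1               : 0# ≢ 1#
    inverse           : ∀ x → x ≢ 0# → Σ Carrier λ y → x * y ≡ 1#
    enumeration       : Carrier ↔ Fin q

record Graph : Set₁ where
  field
    V   : Set
    Adj : V → V → Set

open Graph public

HasOrder : Graph → ℕ → Set
HasOrder G n = V G ↔ Fin n

IsRegular : Graph → ℕ → Set
IsRegular G k = ∀ v → Σ (V G) (Adj G v) ↔ Fin k

-- a cycle of length n: n pairwise distinct vertices v_0,…,v_{n-1}
-- (n ≥ 3) with v_i adjacent to v_{i+1} (indices mod n)
CyclicSucc : ∀ {n} → Fin n → Fin n → Set
CyclicSucc {n} i j = (suc (toℕ i) ≡ toℕ j) ⊎ (suc (toℕ i) ≡ n × toℕ j ≡ 0)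

HasCycleOfLength : Graph → ℕ → Set
HasCycleOfLength G n =
  3 ≤ n × Σ (Fin n → V G) λ f →
    Injective _≡_ _≡_ f × (∀ i j → CyclicSucc i j → Adj G (f i) (f j))

HasGirth : Graph → ℕ → Set
HasGirth G g =
  HasCycleOfLength G g × (∀ n → n < g → ¬ HasCycleOfLength G n)

Isomorphic : Graph → Graph → Set
Isomorphic G H = Σ (V G ↔ V H) λ φ →
  ∀ u v → (Adj G u v → Adj H (Inverse.to φ u) (Inverse.to φ v))
        × (Adj H (Inverse.to φ u) (Inverse.to φ v) → Adj G u v)

-- The graphs H_q and B_q.  Vertices (a,b,c)_r with r = 0 ↦ false,
-- r = 1 ↦ true.

module _ {q : ℕ} (F : FiniteField q) where
  open FiniteField F

  Vertex : Set
  Vertex = Bool × Carrier × Carrier × Carrier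

  bipartite : (Carrier × Carrier × Carrier → Carrier × Carrier × Carrier → Set)
            → Graph
  bipartite I = record { V = Vertex ; Adj = adj }
    where
    adj : Vertex → Vertex → Set
    adj (true  , l) (false , p) = I l p
    adj (false , p) (true  , l) = I l p
    adj (true  , _) (true  , _) = ⊥
    adj (false , _) (false , _) = ⊥

  two : Carrier
  two = 1# + 1#

  H : Graph
  H = bipartite λ { (a , b , c) (x , y , z) →
        y ≡ a * x + b × z ≡ a * a * x + c }

  B : Graph
  B = bipartite λ { (a , b , c) (j , y , z) →
        y ≡ a * j + b × z ≡ a * a * j + two * a * b + c }

-- B_q is the incidence graph between "lines" (a,b,c) and "points" (x,y,z) of F³, the points of a
-- line being (x, ax+b, a²x+2ab+c); replacing c by c+2ab turns it into H_q. A line is parametrised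
-- by x and the lines through a point by their slope a, which gives q-regularity. Between two
-- points of a line of slope a the coordinates change by δ(1, a, a²). Hence two distinct lines meet
-- at most once (a 4-cycle would force (a−a′)δ = 0), and a triangle of lines with slopes a₁, a₂, a₃
-- would give a nonsingular Vandermonde system for its three steps; together with bipartiteness
-- this rules out cycles shorter than 8, and the lines along the sides of a parallelogram spanned
-- by two slopes and two steps form an 8-cycle.

module Submission where

open import Defs
open import Data.Nat as ℕ using (ℕ; zero; suc; s≤s; z≤n; parity)
open import Data.Nat.Properties using (suc-injective; +-suc; *-identityʳ; <⇒≤; n<1+n)
open import Data.Nat.GeneralisedArithmetic using (fold)
open import Data.Parity.Base using (0ℙ)
open import Data.Integer as ℤ using (ℤ; +_; -[1+_]; _⊖_; sign; ∣_∣; _◃_)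
open import Data.Integer.Properties using ([1+m]⊖[1+n]≡m⊖n)
open import Data.Sign as Sign using (Sign)
open import Data.Bool using (Bool; true; false; not)
open import Data.Bool.Properties using (not-involutive)
open import Data.Fin as Fin using (Fin; zero; suc; fromℕ; fromℕ<; inject₁)
open import Data.Fin.Patterns using (0F; 1F; 2F; 3F; 4F; 5F; 6F; 7F)
open import Data.Fin.Properties
  using (toℕ-injective; toℕ-inject₁; toℕ-fromℕ; toℕ-fromℕ<; 2↔Bool; *↔×)
open import Data.Maybe using (Maybe; just; nothing)
open import Data.Product using (Σ; _×_; _,_; proj₁)
open import Data.Product.Properties using (Σ-≡,≡→≡)
open import Data.Product.Function.NonDependent.Propositional using (_×-↔_)
open import Data.Sum using (inj₁; inj₂)
open import Data.Empty using (⊥; ⊥-elim)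
open import Function using (_∘_)
open import Function.Bundles using (_↔_; Inverse; mk↔ₛ′)
open import Function.Definitions using (Injective)
open import Function.Properties.Inverse using (↔-trans; ↔-sym; ↔⇒↣)
open import Relation.Nullary using (¬_; Irrelevant; does; yes; no)
open import Relation.Nullary.Decidable using (via-injection; dec-true; dec-false)
open import Relation.Binary.PropositionalEquality
  using (_≡_; _≢_; refl; sym; trans; cong; cong₂; subst; module ≡-Reasoning)
open import Relation.Binary.Definitions using (DecidableEquality)
open import Axiom.UniquenessOfIdentityProofs using (module Decidable⇒UIP)
open import Algebra.Bundles using (CommutativeRing)

-- The ring solver normalises coefficients by evaluation, so they are taken from ℤ, which maps
-- into every commutative ring; the ring's own (abstract) elements would not compute.
module IntegerCoefficients {c ℓ} (R : CommutativeRing c ℓ) where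
  open CommutativeRing R renaming (refl to ≈-refl; sym to ≈-sym; trans to ≈-trans)
  open import Algebra.Properties.Ring ring
    using (-‿involutive; -0#≈0#; -‿+-comm; -‿distribˡ-*; -‿distribʳ-*)
  open import Algebra.Properties.Semiring.Mult semiring
    using (×-homo-+; ×1-homo-*) renaming (_×_ to _×ₙ_)
  open import Algebra.Properties.CommutativeSemigroup +-commutativeSemigroup using (interchange)
  open import Algebra.Solver.Ring.AlmostCommutativeRing
    using (fromCommutativeRing; _-Raw-AlmostCommutative⟶_)
  open import Relation.Binary.Reasoning.Setoid setoid

  signed : Sign → Carrier → Carrier
  signed Sign.+ x = x
  signed Sign.- x = - x

  fromℤ : ℤ → Carrier
  fromℤ i = signed (sign i) (∣ i ∣ ×ₙ 1#)

  signed-cong : ∀ s {x y} → x ≈ y → signed s x ≈ signed s y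
  signed-cong Sign.+ x≈y = x≈y
  signed-cong Sign.- x≈y = -‿cong x≈y

  signed-* : ∀ s t x y → signed (s Sign.* t) (x * y) ≈ signed s x * signed t y
  signed-* Sign.+ Sign.+ x y = ≈-refl
  signed-* Sign.+ Sign.- x y = -‿distribʳ-* x y
  signed-* Sign.- Sign.+ x y = -‿distribˡ-* x y
  signed-* Sign.- Sign.- x y = begin
    x * y          ≈⟨ -‿involutive (x * y) ⟨
    - - (x * y)    ≈⟨ -‿cong (-‿distribˡ-* x y) ⟩
    - (- x * y)    ≈⟨ -‿distribʳ-* (- x) y ⟩
    - x * - y      ∎

  fromℤ-◃ : ∀ s n → fromℤ (s ◃ n) ≈ signed s (n ×ₙ 1#)
  fromℤ-◃ Sign.+ zero    = ≈-refl
  fromℤ-◃ Sign.- zero    = ≈-sym -0#≈0#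
  fromℤ-◃ Sign.+ (suc n) = ≈-refl
  fromℤ-◃ Sign.- (suc n) = ≈-refl

  fromℤ-⊖ : ∀ m n → fromℤ (m ⊖ n) ≈ m ×ₙ 1# - n ×ₙ 1#
  fromℤ-⊖ m       zero    = ≈-sym (≈-trans (+-congˡ -0#≈0#) (+-identityʳ _))
  fromℤ-⊖ zero    (suc n) = ≈-sym (+-identityˡ _)
  fromℤ-⊖ (suc m) (suc n) = begin
    fromℤ (suc m ⊖ suc n)                ≡⟨ cong fromℤ ([1+m]⊖[1+n]≡m⊖n m n) ⟩
    fromℤ (m ⊖ n)                        ≈⟨ fromℤ-⊖ m n ⟩
    m ×ₙ 1# - n ×ₙ 1#                    ≈⟨ +-identityˡ _ ⟨
    0# + (m ×ₙ 1# - n ×ₙ 1#)             ≈⟨ +-congʳ (-‿inverseʳ 1#) ⟨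
    (1# - 1#) + (m ×ₙ 1# - n ×ₙ 1#)      ≈⟨ interchange 1# (- 1#) (m ×ₙ 1#) (- (n ×ₙ 1#)) ⟩
    (1# + m ×ₙ 1#) + (- 1# - n ×ₙ 1#)    ≈⟨ +-congˡ (-‿+-comm 1# (n ×ₙ 1#)) ⟩
    suc m ×ₙ 1# - suc n ×ₙ 1#            ∎

  fromℤ-+ : ∀ i j → fromℤ (i ℤ.+ j) ≈ fromℤ i + fromℤ j
  fromℤ-+ -[1+ m ] -[1+ n ] = begin
    - (suc (suc (m ℕ.+ n)) ×ₙ 1#)        ≡⟨ cong (λ k → - (suc k ×ₙ 1#)) (+-suc m n) ⟨
    - ((suc m ℕ.+ suc n) ×ₙ 1#)          ≈⟨ -‿cong (×-homo-+ 1# (suc m) (suc n)) ⟩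
    - (suc m ×ₙ 1# + suc n ×ₙ 1#)        ≈⟨ -‿+-comm _ _ ⟨
    - (suc m ×ₙ 1#) + - (suc n ×ₙ 1#)    ∎
  fromℤ-+ -[1+ m ] (+ n)    = ≈-trans (fromℤ-⊖ n (suc m)) (+-comm _ _)
  fromℤ-+ (+ m)    -[1+ n ] = fromℤ-⊖ m (suc n)
  fromℤ-+ (+ m)    (+ n)    = ×-homo-+ 1# m n

  fromℤ-* : ∀ i j → fromℤ (i ℤ.* j) ≈ fromℤ i * fromℤ j
  fromℤ-* i j = begin
    fromℤ (s ◃ (∣ i ∣ ℕ.* ∣ j ∣))             ≈⟨ fromℤ-◃ s (∣ i ∣ ℕ.* ∣ j ∣) ⟩
    signed s ((∣ i ∣ ℕ.* ∣ j ∣) ×ₙ 1#)        ≈⟨ signed-cong s (×1-homo-* ∣ i ∣ ∣ j ∣) ⟩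
    signed s ((∣ i ∣ ×ₙ 1#) * (∣ j ∣ ×ₙ 1#))  ≈⟨ signed-* (sign i) (sign j) _ _ ⟩
    fromℤ i * fromℤ j                          ∎
    where s = sign i Sign.* sign j

  fromℤ-neg : ∀ i → fromℤ (ℤ.- i) ≈ - fromℤ i
  fromℤ-neg -[1+ n ]    = ≈-sym (-‿involutive _)
  fromℤ-neg (+ zero)    = ≈-sym -0#≈0#
  fromℤ-neg (+ (suc n)) = ≈-refl

  homomorphism : ℤ.+-*-rawRing -Raw-AlmostCommutative⟶ fromCommutativeRing R
  homomorphism = record
    { ⟦_⟧    = fromℤ
    ; +-homo = fromℤ-+
    ; *-homo = fromℤ-*
    ; -‿homo = fromℤ-neg
    ; 0-homo = ≈-refl
    ; 1-homo = +-identityʳ 1#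
    }

  fromℤ-≟ : ∀ i j → Maybe (fromℤ i ≈ fromℤ j)
  fromℤ-≟ i j with i ℤ.≟ j
  ... | yes i≡j = just (reflexive (cong fromℤ i≡j))
  ... | no  _   = nothing

  open import Algebra.Solver.Ring ℤ.+-*-rawRing (fromCommutativeRing R) homomorphism fromℤ-≟ public

fold-not-fixed⇒even : ∀ b n → fold b not n ≡ b → parity n ≡ 0ℙ
fold-not-fixed⇒even b     0             _ = refl
fold-not-fixed⇒even true  1             ()
fold-not-fixed⇒even false 1             ()
fold-not-fixed⇒even b     (suc (suc n)) e =
  fold-not-fixed⇒even b n (trans (sym (not-involutive _)) e)

×↔Fin* : ∀ {A B : Set} {m n} → A ↔ Fin m → B ↔ Fin n → (A × B) ↔ Fin (m ℕ.* n)
×↔Fin* A↔m B↔n = ↔-trans (A↔m ×-↔ B↔n) (↔-sym *↔×)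

module _ {G : Graph} where

  closed-walk⇒cycle : ∀ {n} (f : Fin (3 ℕ.+ n) → V G) → Injective _≡_ _≡_ f →
    (∀ i → Adj G (f (inject₁ i)) (f (suc i))) → Adj G (f (fromℕ (2 ℕ.+ n))) (f zero) →
    HasCycleOfLength G (3 ℕ.+ n)
  closed-walk⇒cycle {n} f f-injective step close =
    s≤s (s≤s (s≤s z≤n)) , f , f-injective , adjacent
    where
    adjacent : ∀ i j → CyclicSucc i j → Adj G (f i) (f j)
    adjacent i zero    (inj₁ ())
    adjacent i (suc j) (inj₁ e) =
      subst (λ k → Adj G (f k) (f (suc j)))
            (sym (toℕ-injective (trans (suc-injective e) (sym (toℕ-inject₁ j)))))
            (step j)
    adjacent i zero    (inj₂ (e , _)) =
      subst (λ k → Adj G (f k) (f zero))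
            (sym (toℕ-injective (trans (suc-injective e) (sym (toℕ-fromℕ (2 ℕ.+ n))))))
            close
    adjacent i (suc j) (inj₂ (_ , ()))

  cycle-length-even : (colour : V G → Bool) →
    (∀ {u v} → Adj G u v → colour v ≡ not (colour u)) →
    ∀ {n} → HasCycleOfLength G n → parity n ≡ 0ℙ
  cycle-length-even colour flips {zero}  (() , _)
  cycle-length-even colour flips {suc m} (_ , f , _ , adjacent) =
    fold-not-fixed⇒even (colour (f zero)) (suc m)
      (sym (trans (flips (adjacent last zero (inj₂ (cong suc (toℕ-fromℕ< (n<1+n m)) , refl))))
                  (cong not (along m (n<1+n m)))))
    where
    last : Fin (suc m)
    last = fromℕ< (n<1+n m)

    along : ∀ k (k<n : k ℕ.< suc m) → colour (f (fromℕ< k<n)) ≡ fold (colour (f zero)) not k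
    along zero    _     = refl
    along (suc k) k+1<n =
      trans (flips (adjacent _ _ (inj₁ (trans (cong suc (toℕ-fromℕ< (<⇒≤ k+1<n)))
                                              (sym (toℕ-fromℕ< k+1<n))))))
            (cong not (along k (<⇒≤ k+1<n)))

module _ {q : ℕ} (F : FiniteField q) where
  open FiniteField F

  commutativeRing : CommutativeRing _ _
  commutativeRing = record { isCommutativeRing = isCommutativeRing }

  open CommutativeRing commutativeRing using (_-_; +-assoc; *-identityˡ; zeroʳ; -‿inverseʳ)
  open import Algebra.Properties.Ring (CommutativeRing.ring commutativeRing)
    using (x∙y⁻¹≈ε⇒x≈y; +-identityʳ-unique)
  open IntegerCoefficients commutativeRing using (solve; _:=_; _:+_; _:*_; _:-_; con)

  _≟_ : DecidableEquality Carrier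
  _≟_ = via-injection (↔⇒↣ enumeration) Fin._≟_

  does-≟-≡ : ∀ {x y} → x ≡ y → does (x ≟ y) ≡ true
  does-≟-≡ = dec-true (_ ≟ _)

  does-≟-≢ : ∀ {x y} → x ≢ y → does (x ≟ y) ≡ false
  does-≟-≢ = dec-false (_ ≟ _)

  ≡-irrelevant : {x y : Carrier} → Irrelevant (x ≡ y)
  ≡-irrelevant = Decidable⇒UIP.≡-irrelevant _≟_

  1≢0 : 1# ≢ 0#
  1≢0 = 0≢1 ∘ sym

  x-y≡0⇒x≡y : ∀ {x y} → x - y ≡ 0# → x ≡ y
  x-y≡0⇒x≡y = x∙y⁻¹≈ε⇒x≈y _ _

  x≢y⇒x-y≢0 : ∀ {x y} → x ≢ y → x - y ≢ 0#
  x≢y⇒x-y≢0 x≢y = x≢y ∘ x-y≡0⇒x≡y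

  x*y≡0⇒y≡0 : ∀ {x y} → x ≢ 0# → x * y ≡ 0# → y ≡ 0#
  x*y≡0⇒y≡0 {x} {y} x≢0 xy≡0 with inverse x x≢0
  ... | x⁻¹ , xx⁻¹≡1 = begin
    y                ≡⟨ *-identityˡ y ⟨
    1# * y           ≡⟨ cong (_* y) xx⁻¹≡1 ⟨
    x * x⁻¹ * y      ≡⟨ solve 3 (λ x x⁻¹ y → x :* x⁻¹ :* y := x⁻¹ :* (x :* y)) refl x x⁻¹ y ⟩
    x⁻¹ * (x * y)    ≡⟨ cong (x⁻¹ *_) xy≡0 ⟩
    x⁻¹ * 0#         ≡⟨ zeroʳ x⁻¹ ⟩
    0#               ∎
    where open ≡-Reasoning

  Triple : Set
  Triple = Carrier × Carrier × Carrier

  module _ (I : Triple → Triple → Set) where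

    private
      Γ : Graph
      Γ = bipartite F I

    bipartite-colour-flips : ∀ {u v} → Adj Γ u v → proj₁ v ≡ not (proj₁ u)
    bipartite-colour-flips {true  , _} {false , _} _ = refl
    bipartite-colour-flips {false , _} {true  , _} _ = refl
    bipartite-colour-flips {true  , _} {true  , _} ()
    bipartite-colour-flips {false , _} {false , _} ()

    bipartite-regular : ∀ {k} → (∀ l → Σ Triple (I l) ↔ Fin k) →
      (∀ p → Σ Triple (λ l → I l p) ↔ Fin k) → IsRegular Γ k
    bipartite-regular points-on lines-through (true , l) =
      ↔-trans (mk↔ₛ′ to from (λ _ → refl) from∘to) (points-on l)
      where
      to : Σ (Vertex F) (Adj Γ (true , l)) → Σ Triple (I l)
      to ((false , p) , i) = p , i
      to ((true  , _) , ())
      from : Σ Triple (I l) → Σ (Vertex F) (Adj Γ (true , l))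
      from (p , i) = (false , p) , i
      from∘to : ∀ w → from (to w) ≡ w
      from∘to ((false , _) , _) = refl
      from∘to ((true  , _) , ())
    bipartite-regular points-on lines-through (false , p) =
      ↔-trans (mk↔ₛ′ to from (λ _ → refl) from∘to) (lines-through p)
      where
      to : Σ (Vertex F) (Adj Γ (false , p)) → Σ Triple (λ l → I l p)
      to ((true  , l) , i) = l , i
      to ((false , _) , ())
      from : Σ Triple (λ l → I l p) → Σ (Vertex F) (Adj Γ (false , p))
      from (l , i) = (true , l) , i
      from∘to : ∀ w → from (to w) ≡ w
      from∘to ((true  , _) , _) = refl
      from∘to ((false , _) , ())

    LinesMeetOnce : Set
    LinesMeetOnce = ∀ {l l′ p p′} → l ≢ l′ → I l p → I l′ p → I l p′ → I l′ p′ → p ≡ p′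

    NoTriangles : Set
    NoTriangles = ∀ {l₁ l₂ l₃ p₁ p₂ p₃} → l₁ ≢ l₃ → l₂ ≢ l₃ →
      I l₁ p₁ → I l₂ p₁ → I l₂ p₂ → I l₃ p₂ → I l₃ p₃ → I l₁ p₃ → p₂ ≡ p₃

    no-4-cycle : LinesMeetOnce → ¬ HasCycleOfLength Γ 4
    no-4-cycle meet-once (_ , f , f-injective , adjacent) =
      square (adjacent 0F 1F (inj₁ refl)) (adjacent 1F 2F (inj₁ refl))
             (adjacent 2F 3F (inj₁ refl)) (adjacent 3F 0F (inj₂ (refl , refl)))
             (apart λ ()) (apart λ ())
      where
      apart : ∀ {i j} → i ≢ j → f i ≢ f j
      apart i≢j = i≢j ∘ f-injective

      square : ∀ {v₀ v₁ v₂ v₃} → Adj Γ v₀ v₁ → Adj Γ v₁ v₂ → Adj Γ v₂ v₃ → Adj Γ v₃ v₀ →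
        v₀ ≢ v₂ → v₁ ≢ v₃ → ⊥
      square {true , _} {false , _} {true , _} {false , _} i₀ i₁ i₂ i₃ v₀≢v₂ v₁≢v₃ =
        v₁≢v₃ (cong (false ,_) (meet-once (v₀≢v₂ ∘ cong (true ,_)) i₀ i₁ i₃ i₂))
      square {false , _} {true , _} {false , _} {true , _} i₀ i₁ i₂ i₃ v₀≢v₂ v₁≢v₃ =
        v₀≢v₂ (cong (false ,_) (meet-once (v₁≢v₃ ∘ cong (true ,_)) i₀ i₃ i₁ i₂))
      square {true  , _} {true  , _} () _ _ _ _ _
      square {true  , _} {false , _} {false , _} _ () _ _ _ _
      square {true  , _} {false , _} {true  , _} {true  , _} _ _ () _ _ _
      square {false , _} {false , _} () _ _ _ _ _
      square {false , _} {true  , _} {true  , _} _ () _ _ _ _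
      square {false , _} {true  , _} {false , _} {false , _} _ _ () _ _ _

    no-6-cycle : NoTriangles → ¬ HasCycleOfLength Γ 6
    no-6-cycle no-triangles (_ , f , f-injective , adjacent) =
      hexagon (adjacent 0F 1F (inj₁ refl)) (adjacent 1F 2F (inj₁ refl))
              (adjacent 2F 3F (inj₁ refl)) (adjacent 3F 4F (inj₁ refl))
              (adjacent 4F 5F (inj₁ refl)) (adjacent 5F 0F (inj₂ (refl , refl)))
              (apart λ ()) (apart λ ()) (apart λ ()) (apart λ ())
      where
      apart : ∀ {i j} → i ≢ j → f i ≢ f j
      apart i≢j = i≢j ∘ f-injective

      hexagon : ∀ {v₀ v₁ v₂ v₃ v₄ v₅} →
        Adj Γ v₀ v₁ → Adj Γ v₁ v₂ → Adj Γ v₂ v₃ → Adj Γ v₃ v₄ → Adj Γ v₄ v₅ → Adj Γ v₅ v₀ →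
        v₀ ≢ v₄ → v₁ ≢ v₅ → v₂ ≢ v₄ → v₃ ≢ v₅ → ⊥
      hexagon {true , _} {false , _} {true , _} {false , _} {true , _} {false , _}
              i₀ i₁ i₂ i₃ i₄ i₅ v₀≢v₄ _ v₂≢v₄ v₃≢v₅ =
        v₃≢v₅ (cong (false ,_)
          (no-triangles (v₀≢v₄ ∘ cong (true ,_)) (v₂≢v₄ ∘ cong (true ,_)) i₀ i₁ i₂ i₃ i₄ i₅))
      hexagon {false , _} {true , _} {false , _} {true , _} {false , _} {true , _}
              i₀ i₁ i₂ i₃ i₄ i₅ v₀≢v₄ v₁≢v₅ _ v₃≢v₅ =
        v₀≢v₄ (cong (false ,_) (sym
          (no-triangles (v₁≢v₅ ∘ cong (true ,_)) (v₃≢v₅ ∘ cong (true ,_)) i₁ i₂ i₃ i₄ i₅ i₀)))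
      hexagon {true  , _} {true  , _} () _ _ _ _ _ _ _ _ _
      hexagon {true  , _} {false , _} {false , _} _ () _ _ _ _ _ _ _ _
      hexagon {true  , _} {false , _} {true  , _} {true  , _} _ _ () _ _ _ _ _ _ _
      hexagon {true  , _} {false , _} {true  , _} {false , _} {false , _} _ _ _ () _ _ _ _ _ _
      hexagon {true  , _} {false , _} {true  , _} {false , _} {true  , _} {true  , _}
              _ _ _ _ () _ _ _ _ _
      hexagon {false , _} {false , _} () _ _ _ _ _ _ _ _ _
      hexagon {false , _} {true  , _} {true  , _} _ () _ _ _ _ _ _ _ _
      hexagon {false , _} {true  , _} {false , _} {false , _} _ _ () _ _ _ _ _ _ _
      hexagon {false , _} {true  , _} {false , _} {true  , _} {true  , _} _ _ _ () _ _ _ _ _ _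
      hexagon {false , _} {true  , _} {false , _} {true  , _} {false , _} {false , _}
              _ _ _ _ () _ _ _ _ _

    bipartite-girth-8 : LinesMeetOnce → NoTriangles → HasCycleOfLength Γ 8 → HasGirth Γ 8
    bipartite-girth-8 meet-once no-triangles octagon = octagon , no-shorter-cycle
      where
      even-length : ∀ {n} → HasCycleOfLength Γ n → parity n ≡ 0ℙ
      even-length = cycle-length-even proj₁ (λ {u} {v} → bipartite-colour-flips {u} {v})

      no-shorter-cycle : ∀ n → n ℕ.< 8 → ¬ HasCycleOfLength Γ n
      no-shorter-cycle 0 _ (() , _)
      no-shorter-cycle 1 _ (s≤s () , _)
      no-shorter-cycle 2 _ (s≤s (s≤s ()) , _)
      no-shorter-cycle 3 _ c with () ← even-length c
      no-shorter-cycle 4 _ = no-4-cycle meet-once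
      no-shorter-cycle 5 _ c with () ← even-length c
      no-shorter-cycle 6 _ = no-6-cycle no-triangles
      no-shorter-cycle 7 _ c with () ← even-length c
      no-shorter-cycle (suc (suc (suc (suc (suc (suc (suc (suc _))))))))
        (s≤s (s≤s (s≤s (s≤s (s≤s (s≤s (s≤s (s≤s ()))))))))

  Incident : Triple → Triple → Set
  Incident l p = Adj (B F) (true , l) (false , p)

  incident-irrelevant : ∀ {l p} → Irrelevant (Incident l p)
  incident-irrelevant (e₁ , e₂) (e₁′ , e₂′) = cong₂ _,_ (≡-irrelevant e₁ e₁′) (≡-irrelevant e₂ e₂′)

  intercept : Carrier → Triple → Carrier
  intercept a (x , y , _) = y - a * x

  point-at : Triple → Carrier → Triple
  point-at (a , b , c) x = x , a * x + b , a * a * x + two F * a * b + c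

  line-through : Carrier → Triple → Triple
  line-through a p@(x , _ , z) = a , intercept a p , z - (a * a * x + two F * a * intercept a p)

  incident-point-at : ∀ l x → Incident l (point-at l x)
  incident-point-at l x = refl , refl

  incident⇒≡point-at : ∀ {l x y z} → Incident l (x , y , z) → (x , y , z) ≡ point-at l x
  incident⇒≡point-at (refl , refl) = refl

  incident-line-through : ∀ a p → Incident (line-through a p) p
  incident-line-through a (x , y , z) =
    solve 3 (λ a x y → y := a :* x :+ (y :- a :* x)) refl a x y ,
    solve 5 (λ a x y z t → z := a :* a :* x :+ t :* a :* (y :- a :* x)
                                 :+ (z :- (a :* a :* x :+ t :* a :* (y :- a :* x))))
            refl a x y z (two F)

  incident⇒≡line-through : ∀ {a b c p} → Incident (a , b , c) p → (a , b , c) ≡ line-through a p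
  incident⇒≡line-through {a} {b} {c} {x , _ , _} (refl , refl) = cong₂ (λ b′ c′ → a , b′ , c′)
    (solve 3 (λ a b x → b := (a :* x :+ b) :- a :* x) refl a b x)
    (solve 5 (λ a b c x t → c := (a :* a :* x :+ t :* a :* b :+ c)
                                    :- (a :* a :* x :+ t :* a :* ((a :* x :+ b) :- a :* x)))
           refl a b c x (two F))

  incident-same-x⇒≡ : ∀ {l p p′} → Incident l p → Incident l p′ → proj₁ p ≡ proj₁ p′ → p ≡ p′
  incident-same-x⇒≡ i i′ refl = trans (incident⇒≡point-at i) (sym (incident⇒≡point-at i′))

  incident-same-slope⇒≡ : ∀ {l l′ p} → Incident l p → Incident l′ p → proj₁ l ≡ proj₁ l′ → l ≡ l′
  incident-same-slope⇒≡ i i′ refl =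
    trans (incident⇒≡line-through i) (sym (incident⇒≡line-through i′))

  incident-Δy : ∀ {a b c x y z x′ y′ z′} →
    Incident (a , b , c) (x , y , z) → Incident (a , b , c) (x′ , y′ , z′) →
    y′ - y ≡ a * (x′ - x)
  incident-Δy {a} {b} {x = x} {x′ = x′} (refl , refl) (refl , refl) =
    solve 4 (λ a b x x′ → (a :* x′ :+ b) :- (a :* x :+ b) := a :* (x′ :- x)) refl a b x x′

  incident-Δz : ∀ {a b c x y z x′ y′ z′} →
    Incident (a , b , c) (x , y , z) → Incident (a , b , c) (x′ , y′ , z′) →
    z′ - z ≡ a * a * (x′ - x)
  incident-Δz {a} {b} {c} {x = x} {x′ = x′} (refl , refl) (refl , refl) =
    solve 6 (λ a b c x x′ t → (a :* a :* x′ :+ t :* a :* b :+ c)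
                                :- (a :* a :* x :+ t :* a :* b :+ c)
                                := a :* a :* (x′ :- x))
            refl a b c x x′ (two F)

  lines-meet-once : LinesMeetOnce Incident
  lines-meet-once {a , _} {a′ , _} {x , y , _} {x′ , y′ , _} l≢l′ lp l′p lp′ l′p′ with a ≟ a′
  ... | yes a≡a′ = ⊥-elim (l≢l′ (incident-same-slope⇒≡ lp l′p a≡a′))
  ... | no  a≢a′ = incident-same-x⇒≡ lp lp′
                     (sym (x-y≡0⇒x≡y (x*y≡0⇒y≡0 (x≢y⇒x-y≢0 a≢a′) slopes-times-step)))
    where
    open ≡-Reasoning
    slopes-times-step : (a - a′) * (x′ - x) ≡ 0#
    slopes-times-step = begin
      (a - a′) * (x′ - x)
        ≡⟨ solve 4 (λ a a′ x x′ → (a :- a′) :* (x′ :- x) := a :* (x′ :- x) :- a′ :* (x′ :- x))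
                   refl a a′ x x′ ⟩
      a * (x′ - x) - a′ * (x′ - x)
        ≡⟨ cong₂ _-_ (incident-Δy lp lp′) (incident-Δy l′p l′p′) ⟨
      (y′ - y) - (y′ - y)
        ≡⟨ -‿inverseʳ (y′ - y) ⟩
      0# ∎

  -- The steps x₂ - x₁, x₃ - x₂, x₁ - x₃ of the triangle satisfy a Vandermonde system in the
  -- slopes: they sum to zero, and so do their multiples by the slopes and by the squared slopes.
  no-triangles : NoTriangles Incident
  no-triangles {a₁ , _} {a₂ , _} {a₃ , _} {x₁ , y₁ , z₁} {x₂ , y₂ , z₂} {x₃ , y₃ , z₃}
               l₁≢l₃ l₂≢l₃ i₁₁ i₂₁ i₂₂ i₃₂ i₃₃ i₁₃ with a₃ ≟ a₁ | a₃ ≟ a₂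
  ... | yes a₃≡a₁ | _         = ⊥-elim (l₁≢l₃ (incident-same-slope⇒≡ i₁₃ i₃₃ (sym a₃≡a₁)))
  ... | no  _     | yes a₃≡a₂ = ⊥-elim (l₂≢l₃ (incident-same-slope⇒≡ i₂₂ i₃₂ (sym a₃≡a₂)))
  ... | no  a₃≢a₁ | no  a₃≢a₂ =
    incident-same-x⇒≡ i₃₂ i₃₃
      (sym (x-y≡0⇒x≡y (x*y≡0⇒y≡0 (x≢y⇒x-y≢0 a₃≢a₂) (x*y≡0⇒y≡0 (x≢y⇒x-y≢0 a₃≢a₁) vandermonde))))
    where
    open ≡-Reasoning
    telescope : ∀ u₁ u₂ u₃ → (u₂ - u₁) + (u₃ - u₂) + (u₁ - u₃) ≡ 0#
    telescope = solve 3 (λ u₁ u₂ u₃ → (u₂ :- u₁) :+ (u₃ :- u₂) :+ (u₁ :- u₃) := con (+ 0)) refl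

    slopes : a₂ * (x₂ - x₁) + a₃ * (x₃ - x₂) + a₁ * (x₁ - x₃) ≡ 0#
    slopes = begin
      a₂ * (x₂ - x₁) + a₃ * (x₃ - x₂) + a₁ * (x₁ - x₃)
        ≡⟨ cong₂ _+_ (cong₂ _+_ (incident-Δy i₂₁ i₂₂) (incident-Δy i₃₂ i₃₃)) (incident-Δy i₁₃ i₁₁) ⟨
      (y₂ - y₁) + (y₃ - y₂) + (y₁ - y₃)
        ≡⟨ telescope y₁ y₂ y₃ ⟩
      0# ∎

    squares : a₂ * a₂ * (x₂ - x₁) + a₃ * a₃ * (x₃ - x₂) + a₁ * a₁ * (x₁ - x₃) ≡ 0#
    squares = begin
      a₂ * a₂ * (x₂ - x₁) + a₃ * a₃ * (x₃ - x₂) + a₁ * a₁ * (x₁ - x₃)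
        ≡⟨ cong₂ _+_ (cong₂ _+_ (incident-Δz i₂₁ i₂₂) (incident-Δz i₃₂ i₃₃)) (incident-Δz i₁₃ i₁₁) ⟨
      (z₂ - z₁) + (z₃ - z₂) + (z₁ - z₃)
        ≡⟨ telescope z₁ z₂ z₃ ⟩
      0# ∎

    vandermonde : (a₃ - a₁) * ((a₃ - a₂) * (x₃ - x₂)) ≡ 0#
    vandermonde = begin
      (a₃ - a₁) * ((a₃ - a₂) * (x₃ - x₂))
        ≡⟨ solve 6 (λ a₁ a₂ a₃ x₁ x₂ x₃ →
             (a₃ :- a₁) :* ((a₃ :- a₂) :* (x₃ :- x₂))
             := (a₂ :* a₂ :* (x₂ :- x₁) :+ a₃ :* a₃ :* (x₃ :- x₂) :+ a₁ :* a₁ :* (x₁ :- x₃))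
                :- (a₁ :+ a₂) :* (a₂ :* (x₂ :- x₁) :+ a₃ :* (x₃ :- x₂) :+ a₁ :* (x₁ :- x₃)))
           refl a₁ a₂ a₃ x₁ x₂ x₃ ⟩
      (a₂ * a₂ * (x₂ - x₁) + a₃ * a₃ * (x₃ - x₂) + a₁ * a₁ * (x₁ - x₃))
        - (a₁ + a₂) * (a₂ * (x₂ - x₁) + a₃ * (x₃ - x₂) + a₁ * (x₁ - x₃))
        ≡⟨ cong₂ (λ u v → u - (a₁ + a₂) * v) squares slopes ⟩
      0# - (a₁ + a₂) * 0#
        ≡⟨ solve 2 (λ a₁ a₂ → con (+ 0) :- (a₁ :+ a₂) :* con (+ 0) := con (+ 0)) refl a₁ a₂ ⟩
      0# ∎

  shift : Triple → Carrier → Carrier → Triple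
  shift (x , y , z) a δ = x + δ , y + a * δ , z + a * a * δ

  incident-shift : ∀ {l p} δ → Incident l p → Incident l (shift p (proj₁ l) δ)
  incident-shift {a , b , c} {x , _ , _} δ (refl , refl) =
    solve 4 (λ a b x δ → a :* x :+ b :+ a :* δ := a :* (x :+ δ) :+ b) refl a b x δ ,
    solve 6 (λ a b c x δ t → a :* a :* x :+ t :* a :* b :+ c :+ a :* a :* δ
                               := a :* a :* (x :+ δ) :+ t :* a :* b :+ c)
            refl a b c x δ (two F)

  shift-comm : ∀ p a a′ δ δ′ → shift (shift p a δ) a′ δ′ ≡ shift (shift p a′ δ′) a δ
  shift-comm (x , y , z) a a′ δ δ′ = cong₂ _,_
    (solve 3 (λ x δ δ′ → x :+ δ :+ δ′ := x :+ δ′ :+ δ) refl x δ δ′)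
    (cong₂ _,_
      (solve 5 (λ y a a′ δ δ′ → y :+ a :* δ :+ a′ :* δ′ := y :+ a′ :* δ′ :+ a :* δ)
               refl y a a′ δ δ′)
      (solve 5 (λ z a a′ δ δ′ → z :+ a :* a :* δ :+ a′ :* a′ :* δ′
                                  := z :+ a′ :* a′ :* δ′ :+ a :* a :* δ)
               refl z a a′ δ δ′))

  intercept-shift-along : ∀ p a δ → intercept a (shift p a δ) ≡ intercept a p
  intercept-shift-along (x , y , _) a δ =
    solve 4 (λ x y a δ → (y :+ a :* δ) :- a :* (x :+ δ) := y :- a :* x) refl x y a δ

  intercept-shift : ∀ p a a′ δ → intercept a′ (shift p a δ) ≡ intercept a′ p + δ * (a - a′)
  intercept-shift (x , y , _) a a′ δ =
    solve 5 (λ x y a a′ δ → (y :+ a :* δ) :- a′ :* (x :+ δ) := (y :- a′ :* x) :+ δ :* (a :- a′))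
            refl x y a a′ δ

  intercept-shift-≢ : ∀ p {a a′ δ} → a ≢ a′ → δ ≢ 0# → intercept a′ (shift p a δ) ≢ intercept a′ p
  intercept-shift-≢ p {a} {a′} {δ} a≢a′ δ≢0 eq =
    x≢y⇒x-y≢0 a≢a′ (x*y≡0⇒y≡0 δ≢0 (+-identityʳ-unique (intercept a′ p) (δ * (a - a′))
      (trans (sym (intercept-shift p a a′ δ)) eq)))

  -- The parallelogram p₀, p₀ + d(1,r,r²), p₀ + d(1,r,r²) + e(1,s,s²), p₀ + e(1,s,s²) and the
  -- lines along its sides.
  module Octagon (p₀ : Triple) {r s d e : Carrier} (r≢s : r ≢ s) (d≢0 : d ≢ 0#) (e≢0 : e ≢ 0#) where

    p₂ p₄ p₆ : Triple
    p₂ = shift p₀ r d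
    p₄ = shift p₂ s e
    p₆ = shift p₀ s e

    octagon : Fin 8 → Vertex F
    octagon 0F = false , p₀
    octagon 1F = true  , line-through r p₀
    octagon 2F = false , p₂
    octagon 3F = true  , line-through s p₂
    octagon 4F = false , p₄
    octagon 5F = true  , line-through r p₆
    octagon 6F = false , p₆
    octagon 7F = true  , line-through s p₀

    -- Points are told apart by their intercepts for the slopes r and s, lines by their slope
    -- and by whether their intercept agrees with that of p₀.
    vertex-code : Bool → Bool → Bool → Fin 8
    vertex-code false true  true  = 0F
    vertex-code true  true  true  = 1F
    vertex-code false true  false = 2F
    vertex-code true  false false = 3F
    vertex-code false false false = 4F
    vertex-code true  true  false = 5F
    vertex-code false false true  = 6F
    vertex-code true  false true  = 7F

    octagon-index : Vertex F → Fin 8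
    octagon-index (false , p) =
      vertex-code false (does (intercept r p ≟ intercept r p₀))
                        (does (intercept s p ≟ intercept s p₀))
    octagon-index (true , a , b , _) =
      vertex-code true (does (a ≟ r)) (does (b ≟ intercept a p₀))

    s≢r : s ≢ r
    s≢r = r≢s ∘ sym

    p₂-off-s : intercept s p₂ ≢ intercept s p₀
    p₂-off-s = intercept-shift-≢ p₀ r≢s d≢0

    p₄-off-r : intercept r p₄ ≢ intercept r p₀
    p₄-off-r eq = intercept-shift-≢ p₂ s≢r e≢0 (trans eq (sym (intercept-shift-along p₀ r d)))

    p₄-off-s : intercept s p₄ ≢ intercept s p₀
    p₄-off-s eq = p₂-off-s (trans (sym (intercept-shift-along p₂ s e)) eq)

    p₆-off-r : intercept r p₆ ≢ intercept r p₀
    p₆-off-r = intercept-shift-≢ p₀ s≢r e≢0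

    octagon-index-octagon : ∀ i → octagon-index (octagon i) ≡ i
    octagon-index-octagon 0F = cong₂ (vertex-code false) (does-≟-≡ refl) (does-≟-≡ refl)
    octagon-index-octagon 1F = cong₂ (vertex-code true)  (does-≟-≡ refl) (does-≟-≡ refl)
    octagon-index-octagon 2F = cong₂ (vertex-code false) (does-≟-≡ (intercept-shift-along p₀ r d))
                                                         (does-≟-≢ p₂-off-s)
    octagon-index-octagon 3F = cong₂ (vertex-code true)  (does-≟-≢ s≢r) (does-≟-≢ p₂-off-s)
    octagon-index-octagon 4F = cong₂ (vertex-code false) (does-≟-≢ p₄-off-r) (does-≟-≢ p₄-off-s)
    octagon-index-octagon 5F = cong₂ (vertex-code true)  (does-≟-≡ refl) (does-≟-≢ p₆-off-r)
    octagon-index-octagon 6F = cong₂ (vertex-code false) (does-≟-≢ p₆-off-r)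
                                                         (does-≟-≡ (intercept-shift-along p₀ s e))
    octagon-index-octagon 7F = cong₂ (vertex-code true)  (does-≟-≢ s≢r) (does-≟-≡ refl)

    octagon-injective : Injective _≡_ _≡_ octagon
    octagon-injective {i} {j} eq = begin
      i                          ≡⟨ octagon-index-octagon i ⟨
      octagon-index (octagon i)  ≡⟨ cong octagon-index eq ⟩
      octagon-index (octagon j)  ≡⟨ octagon-index-octagon j ⟩
      j                          ∎
      where open ≡-Reasoning

    octagon-step : ∀ i → Adj (B F) (octagon (inject₁ i)) (octagon (suc i))
    octagon-step 0F = incident-line-through r p₀
    octagon-step 1F = incident-shift d (incident-line-through r p₀)
    octagon-step 2F = incident-line-through s p₂
    octagon-step 3F = incident-shift e (incident-line-through s p₂)
    octagon-step 4F = subst (Incident (line-through r p₆)) (shift-comm p₀ s r e d)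
                            (incident-shift d (incident-line-through r p₆))
    octagon-step 5F = incident-line-through r p₆
    octagon-step 6F = incident-shift e (incident-line-through s p₀)

    octagon-cycle : HasCycleOfLength (B F) 8
    octagon-cycle =
      closed-walk⇒cycle {B F} octagon octagon-injective octagon-step (incident-line-through s p₀)

  B-girth : HasGirth (B F) 8
  B-girth = bipartite-girth-8 Incident lines-meet-once no-triangles
              (Octagon.octagon-cycle (0# , 0# , 0#) 0≢1 1≢0 1≢0)

  points-on : ∀ l → Σ Triple (Incident l) ↔ Carrier
  points-on l =
    mk↔ₛ′ (proj₁ ∘ proj₁) (λ x → point-at l x , incident-point-at l x) (λ _ → refl) from∘to
    where
    from∘to : ∀ w → (point-at l (proj₁ (proj₁ w)) , incident-point-at l (proj₁ (proj₁ w))) ≡ w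
    from∘to ((_ , _ , _) , refl , refl) = refl

  lines-through : ∀ p → Σ Triple (λ l → Incident l p) ↔ Carrier
  lines-through p =
    mk↔ₛ′ (proj₁ ∘ proj₁) (λ a → line-through a p , incident-line-through a p) (λ _ → refl) from∘to
    where
    from∘to : ∀ w → (line-through (proj₁ (proj₁ w)) p , incident-line-through (proj₁ (proj₁ w)) p)
                  ≡ w
    from∘to (_ , i) = Σ-≡,≡→≡ (sym (incident⇒≡line-through i) , incident-irrelevant _ _)

  B-regular : IsRegular (B F) q
  B-regular = bipartite-regular Incident (λ l → ↔-trans (points-on l) enumeration)
                                         (λ p → ↔-trans (lines-through p) enumeration)

  vertex-count : Vertex F ↔ Fin (2 ℕ.* q ℕ.^ 3)
  vertex-count = subst (λ k → Vertex F ↔ Fin (2 ℕ.* (q ℕ.* (q ℕ.* k)))) (sym (*-identityʳ q))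
    (×↔Fin* (↔-sym 2↔Bool) (×↔Fin* enumeration (×↔Fin* enumeration enumeration)))

  shear : Vertex F ↔ Vertex F
  shear = mk↔ₛ′ to from to∘from from∘to
    where
    to from : Vertex F → Vertex F
    to   (true , a , b , c) = true , a , b , two F * a * b + c
    to   (false , p)        = false , p
    from (true , a , b , c) = true , a , b , c - two F * a * b
    from (false , p)        = false , p

    to∘from : ∀ v → to (from v) ≡ v
    to∘from (true , a , b , c) = cong (λ c′ → true , a , b , c′)
      (solve 4 (λ t a b c → t :* a :* b :+ (c :- t :* a :* b) := c) refl (two F) a b c)
    to∘from (false , _) = refl

    from∘to : ∀ v → from (to v) ≡ v
    from∘to (true , a , b , c) = cong (λ c′ → true , a , b , c′)
      (solve 4 (λ t a b c → (t :* a :* b :+ c) :- t :* a :* b := c) refl (two F) a b c)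
    from∘to (false , _) = refl

  B≅H : Isomorphic (B F) (H F)
  B≅H = shear , preserves
    where
    B⇒H : ∀ {a b c x y z} → Incident (a , b , c) (x , y , z) →
      Adj (H F) (true , a , b , two F * a * b + c) (false , x , y , z)
    B⇒H (e₁ , e₂) = e₁ , trans e₂ (+-assoc _ _ _)

    H⇒B : ∀ {a b c x y z} → Adj (H F) (true , a , b , two F * a * b + c) (false , x , y , z) →
      Incident (a , b , c) (x , y , z)
    H⇒B (e₁ , e₂) = e₁ , trans e₂ (sym (+-assoc _ _ _))

    preserves : ∀ u v → (Adj (B F) u v → Adj (H F) (Inverse.to shear u) (Inverse.to shear v))
                      × (Adj (H F) (Inverse.to shear u) (Inverse.to shear v) → Adj (B F) u v)
    preserves (true  , _) (false , _) = B⇒H , H⇒B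
    preserves (false , _) (true  , _) = B⇒H , H⇒B
    preserves (true  , _) (true  , _) = (λ ()) , (λ ())
    preserves (false , _) (false , _) = (λ ()) , (λ ())

open import Data.Nat using (_*_; _^_)

-- Every finite field has prime power order, so the hypothesis on q carries no extra information.
lemma2 : ∀ {q : ℕ} → IsPrimePower q → (F : FiniteField q) →
    IsRegular (B F) q × HasGirth (B F) 8 × HasOrder (B F) (2 * q ^ 3)
      × Isomorphic (B F) (H F)
lemma2 _ F = B-regular F , B-girth F , vertex-count F , B≅H F
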